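{- Let $f$ be a $k$-homogeneous $n$-variable Boolean function and let $U$ be a $k$-dimensional linear subspace of $\mathbb{F}_2^n$. Then $U\in N_k(f)$ if and only if $U^\perp\in N_{n-k}(\overline{f})$.
   Context: A Boolean function in algebraic normal form (ANF) is a sum $f=m_1+\dots+m_t$ of distinct monomials $x_I=\prod_{i\in I}x_i$, $I\subseteq[n]$; $f$ is $k$-homogeneous if all monomials have degree $k$. The complement of $x_I$ is $\overline{x_I}=x_{[n]\setminus I}$, and $\overline{f}=\overline{m_1}+\dots+\overline{m_t}$. For a Boolean function $g$ and $j\in\{0,\dots,n\}$, $N_j(g)$ is the set of $j$-dimensional linear subspaces $V$ of $\mathbb{F}_2^n$ with $\sum_{x\in V}g(x)\neq0$. $U^\perp$ is the orthogonal complement of $U$ with respect to the standard dot product. -}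

module Defs where

open import Data.Bool using (Bool; true; false; _∧_; _∨_; _xor_; not)
open import Data.Nat using (ℕ; zero; suc)
open import Data.Vec using (Vec; []; _∷_; zipWith; foldr; replicate)
open import Data.List using (List; [_]; _++_; map)
import Data.List as L
open import Data.Fin.Subset using (Subset; ∁; ∣_∣)
open import Data.Product using (Σ; _×_)
open import Relation.Binary.PropositionalEquality using (_≡_)

-- Vectors of F₂ⁿ, with Bool as F₂ (false = 0, true = 1; _xor_ = +, _∧_ = ·).
BVec : ℕ → Set
BVec n = Vec Bool n

zeroV : ∀ {n} → BVec n
zeroV = replicate _ false

_⊕_ : ∀ {n} → BVec n → BVec n → BVec n
_⊕_ = zipWith _xor_

dot : ∀ {n} → BVec n → BVec n → Bool
dot u x = foldr _ _xor_ false (zipWith _∧_ u x)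

allVecs : (n : ℕ) → List (BVec n)
allVecs zero = [ [] ]
allVecs (suc n) = map (false ∷_) (allVecs n) ++ map (true ∷_) (allVecs n)

xorSum : List Bool → Bool
xorSum = L.foldr _xor_ false

BoolFun : ℕ → Set
BoolFun n = BVec n → Bool

-- A Boolean function in ANF: the set of monomials x_I occurring in it,
-- given by its characteristic function on subsets I ⊆ [n] (monomials are distinct by construction).
ANF : ℕ → Set
ANF n = Subset n → Bool

monomial : ∀ {n} → Subset n → BVec n → Bool
monomial I x = foldr _ _∧_ true (zipWith (λ a b → not a ∨ b) I x)

eval : ∀ {n} → ANF n → BoolFun n
eval {n} f x = xorSum (map (λ I → f I ∧ monomial I x) (allVecs n))

Homogeneous : ∀ {n} → ℕ → ANF n → Set
Homogeneous k f = ∀ I → f I ≡ true → ∣ I ∣ ≡ k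

complementANF : ∀ {n} → ANF n → ANF n
complementANF f I = f (∁ I)

VSet : ℕ → Set
VSet n = BVec n → Bool

IsSubspace : ∀ {n} → VSet n → Set
IsSubspace V = (V zeroV ≡ true) ×
  (∀ x y → V x ≡ true → V y ≡ true → V (x ⊕ y) ≡ true)

lincomb : ∀ {n j} → Vec Bool j → Vec (BVec n) j → BVec n
lincomb [] [] = zeroV
lincomb (c ∷ cs) (b ∷ bs) = zipWith (λ bi r → (c ∧ bi) xor r) b (lincomb cs bs)

LinIndep : ∀ {n j} → Vec (BVec n) j → Set
LinIndep {j = j} b = ∀ c → lincomb c b ≡ zeroV → c ≡ replicate j false

IsBasis : ∀ {n j} → VSet n → Vec (BVec n) j → Set
IsBasis V b = LinIndep b ×
  ((∀ c → V (lincomb c b) ≡ true) × (∀ x → V x ≡ true → Σ _ (λ c → lincomb c b ≡ x)))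

HasDim : ∀ {n} → VSet n → ℕ → Set
HasDim {n} V j = Σ (Vec (BVec n) j) (IsBasis V)

sumOver : ∀ {n} → VSet n → BoolFun n → Bool
sumOver {n} V g = xorSum (map (λ x → V x ∧ g x) (allVecs n))

InN : ∀ {n} → ℕ → BoolFun n → VSet n → Set
InN j g V = IsSubspace V × HasDim V j × (sumOver V g ≡ true)

perp : ∀ {n} → VSet n → VSet n
perp {n} U x = L.foldr (λ u r → (not (U u) ∨ not (dot u x)) ∧ r) true (allVecs n)

-- Expanding f into monomials, both sides become sums over the monomials x_I of f, all with
-- |I| = k = dim U, so it suffices to compare ∑_{x∈U} x_I with ∑_{y∈U⊥} y_{∁I}. For a subspace
-- W, ∑_{x∈W} x_J = 1 exactly when the coordinate projection W → F₂^J is bijective: a nonzero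
-- w ∈ W with vanishing J-coordinates makes x ↦ x + w pair off the points where x_J = 1, and
-- otherwise exactly one point of W has all its J-coordinates equal to 1. For W = U this says
-- that the square minor M of a basis matrix of U on the columns I is invertible; for W = U⊥
-- and J = ∁I it says that Mᵀ is. A square matrix over a finite field is invertible iff its
-- transpose is, and then U⊥ projects isomorphically onto F₂^{∁I}, so dim U⊥ = n − k as well.

module Submission where

open import Algebra.Bundles using (CommutativeRing; CommutativeMonoid)
import Data.Bool as Bool
open Bool using (Bool; true; false; _∧_; _∨_; _xor_; not)
open import Data.Bool.Properties
  using (xor-assoc; xor-comm; xor-identityʳ; xor-same; xor-∧-commutativeRing;
         ∧-comm; ∧-distribʳ-xor; ∧-zeroʳ; ∧-commutativeMonoid;
         ¬-not; not-injective; not-involutive)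
open import Data.Empty using (⊥-elim)
import Data.Fin as Fin
open Fin using (Fin)
open import Data.Fin.Properties using (2↔Bool; any?; injective⇒≤; punchOut-injective)
open import Data.Fin.Subset using (Subset; ∁; ∣_∣)
open import Data.Fin.Subset.Properties using (∣∁p∣≡n∸∣p∣)
open import Data.List using (List; []; _∷_)
import Data.List as L
import Data.List.Properties as LP
open import Data.List.Membership.Propositional using (_∈_)
open import Data.List.Membership.Propositional.Properties using (∈-map⁺; ∈-++⁺ˡ; ∈-++⁺ʳ)
open import Data.List.Relation.Unary.Any using (here; there)
open import Data.Nat using (ℕ; zero; suc; _∸_; _^_)
open import Data.Nat.Properties using (1+n≰n)
open import Data.Product using (∃; _×_; _,_; proj₁; proj₂)
open import Data.Vec as Vec using (Vec; []; _∷_; zipWith; replicate)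
import Data.Vec.Properties as VP
open VP using (≡-dec; zipWith-assoc; zipWith-identityˡ; zipWith-identityʳ)
import Data.Vec.Recursive as Vecʳ
import Data.Vec.Recursive.Properties as Vecʳ
open import Data.Vec.Relation.Unary.All using (All; []; _∷_)
import Data.Vec.Relation.Unary.All as All
import Data.Vec.Relation.Unary.All.Properties as All
open import Function using (_∘_; case_of_)
open import Function.Bundles using (_↔_; _⇔_; mk↔ₛ′; mk⇔; Inverse; Injection)
open import Function.Definitions using (Injective; StrictlySurjective)
open import Function.Properties.Inverse using (↔-trans; ↔-sym; ↔⇒↣)
open import Relation.Binary.PropositionalEquality
open import Relation.Nullary using (yes; no; contradiction)

open import Defs

open import Algebra.Properties.CommutativeSemigroup
  (CommutativeRing.+-commutativeSemigroup xor-∧-commutativeRing)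
  using () renaming (interchange to xor-interchange)
open import Algebra.Properties.CommutativeSemigroup
  (CommutativeMonoid.commutativeSemigroup ∧-commutativeMonoid)
  using () renaming (x∙yz≈y∙xz to ∧-rearrange)

private
  variable
    n m : ℕ

xor≡false⇒≡ : ∀ a b → a xor b ≡ false → a ≡ b
xor≡false⇒≡ false false _ = refl
xor≡false⇒≡ true  true  _ = refl

≡true⇔⇒≡ : ∀ {a b} → (a ≡ true → b ≡ true) → (b ≡ true → a ≡ true) → a ≡ b
≡true⇔⇒≡ {false} {false} _ _ = refl
≡true⇔⇒≡ {false} {true}  _ b⇒a = b⇒a refl
≡true⇔⇒≡ {true}  {false} a⇒b _ = sym (a⇒b refl)
≡true⇔⇒≡ {true}  {true}  _ _ = refl

∧≡true⁻ : ∀ {a b} → a ∧ b ≡ true → a ≡ true × b ≡ true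
∧≡true⁻ {true} {true} _ = refl , refl

-- The vector space F₂ⁿ

⊕-assoc : (x y z : BVec n) → (x ⊕ y) ⊕ z ≡ x ⊕ (y ⊕ z)
⊕-assoc = zipWith-assoc xor-assoc

⊕-identityˡ : (x : BVec n) → zeroV ⊕ x ≡ x
⊕-identityˡ = zipWith-identityˡ (λ _ → refl)

⊕-identityʳ : (x : BVec n) → x ⊕ zeroV ≡ x
⊕-identityʳ = zipWith-identityʳ xor-identityʳ

⊕-self : (x : BVec n) → x ⊕ x ≡ zeroV
⊕-self []      = refl
⊕-self (a ∷ x) = cong₂ _∷_ (xor-same a) (⊕-self x)

⊕-cancelʳ : (x w : BVec n) → (x ⊕ w) ⊕ w ≡ x
⊕-cancelʳ x w = trans (⊕-assoc x w w) (trans (cong (x ⊕_) (⊕-self w)) (⊕-identityʳ x))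

⊕≡zero⇒≡ : (x y : BVec n) → x ⊕ y ≡ zeroV → x ≡ y
⊕≡zero⇒≡ []      []      _ = refl
⊕≡zero⇒≡ (a ∷ x) (b ∷ y) e =
  cong₂ _∷_ (xor≡false⇒≡ a b (cong Vec.head e)) (⊕≡zero⇒≡ x y (cong Vec.tail e))

Additive : (BVec n → BVec m) → Set
Additive A = ∀ x y → A (x ⊕ y) ≡ A x ⊕ A y

additive-zero : {A : BVec n → BVec m} → Additive A → A zeroV ≡ zeroV
additive-zero {A = A} add = begin
  A zeroV                      ≡⟨ sym (⊕-cancelʳ (A zeroV) (A zeroV)) ⟩
  (A zeroV ⊕ A zeroV) ⊕ A zeroV ≡⟨ cong (_⊕ A zeroV) (sym (add zeroV zeroV)) ⟩
  A (zeroV ⊕ zeroV) ⊕ A zeroV   ≡⟨ cong (λ z → A z ⊕ A zeroV) (⊕-self zeroV) ⟩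
  A zeroV ⊕ A zeroV             ≡⟨ ⊕-self (A zeroV) ⟩
  zeroV                         ∎
  where open ≡-Reasoning

TrivialKernelOn : VSet n → (BVec n → BVec m) → Set
TrivialKernelOn W A = ∀ x → W x ≡ true → A x ≡ zeroV → x ≡ zeroV

TrivialKernel : (BVec n → BVec m) → Set
TrivialKernel A = ∀ x → A x ≡ zeroV → x ≡ zeroV

trivialKernelOn⇒injectiveOn : {W : VSet n} → IsSubspace W →
                              {A : BVec n → BVec m} → Additive A → TrivialKernelOn W A →
                              ∀ {x y} → W x ≡ true → W y ≡ true → A x ≡ A y → x ≡ y
trivialKernelOn⇒injectiveOn (_ , ⊕∈W) {A} add ker {x} {y} x∈W y∈W Ax≡Ay =
  ⊕≡zero⇒≡ x y (ker (x ⊕ y) (⊕∈W x y x∈W y∈W) (begin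
    A (x ⊕ y)     ≡⟨ add x y ⟩
    A x ⊕ A y     ≡⟨ cong (_⊕ A y) Ax≡Ay ⟩
    A y ⊕ A y     ≡⟨ ⊕-self (A y) ⟩
    zeroV         ∎))
  where open ≡-Reasoning

dot-comm : (x y : BVec n) → dot x y ≡ dot y x
dot-comm []      []      = refl
dot-comm (a ∷ x) (b ∷ y) = cong₂ _xor_ (∧-comm a b) (dot-comm x y)

dot-zeroˡ : (y : BVec n) → dot zeroV y ≡ false
dot-zeroˡ []      = refl
dot-zeroˡ (_ ∷ y) = dot-zeroˡ y

dot-zeroʳ : (x : BVec n) → dot x zeroV ≡ false
dot-zeroʳ x = trans (dot-comm x zeroV) (dot-zeroˡ x)

dot-⊕ˡ : (x y z : BVec n) → dot (x ⊕ y) z ≡ dot x z xor dot y z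
dot-⊕ˡ []      []      []      = refl
dot-⊕ˡ (a ∷ x) (b ∷ y) (c ∷ z) = begin
  ((a xor b) ∧ c) xor dot (x ⊕ y) z
    ≡⟨ cong₂ _xor_ (∧-distribʳ-xor c a b) (dot-⊕ˡ x y z) ⟩
  ((a ∧ c) xor (b ∧ c)) xor (dot x z xor dot y z)
    ≡⟨ xor-interchange (a ∧ c) (b ∧ c) (dot x z) (dot y z) ⟩
  ((a ∧ c) xor dot x z) xor ((b ∧ c) xor dot y z) ∎
  where open ≡-Reasoning

dot-⊕ʳ : (x y z : BVec n) → dot z (x ⊕ y) ≡ dot z x xor dot z y
dot-⊕ʳ x y z = begin
  dot z (x ⊕ y)         ≡⟨ dot-comm z (x ⊕ y) ⟩
  dot (x ⊕ y) z         ≡⟨ dot-⊕ˡ x y z ⟩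
  dot x z xor dot y z   ≡⟨ cong₂ _xor_ (dot-comm x z) (dot-comm y z) ⟩
  dot z x xor dot z y   ∎
  where open ≡-Reasoning

orthogonal-to-all⇒zero : (r : BVec n) → (∀ c → dot c r ≡ false) → r ≡ zeroV
orthogonal-to-all⇒zero []      _   = refl
orthogonal-to-all⇒zero (a ∷ r) ⊥r = cong₂ _∷_ a≡false (orthogonal-to-all⇒zero r (⊥r ∘ (false ∷_)))
  where
  a≡false : a ≡ false
  a≡false = trans (sym (trans (cong (a xor_) (dot-zeroˡ r)) (xor-identityʳ a))) (⊥r (true ∷ zeroV))

dot-injectiveˡ : (x x′ : BVec n) → (∀ y → dot x y ≡ dot x′ y) → x ≡ x′
dot-injectiveˡ x x′ same = ⊕≡zero⇒≡ x x′ (orthogonal-to-all⇒zero (x ⊕ x′) ⊥x⊕x′)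
  where
  open ≡-Reasoning
  ⊥x⊕x′ : ∀ y → dot y (x ⊕ x′) ≡ false
  ⊥x⊕x′ y = begin
    dot y (x ⊕ x′)        ≡⟨ dot-comm y (x ⊕ x′) ⟩
    dot (x ⊕ x′) y        ≡⟨ dot-⊕ˡ x x′ y ⟩
    dot x y xor dot x′ y  ≡⟨ cong (_xor dot x′ y) (same y) ⟩
    dot x′ y xor dot x′ y ≡⟨ xor-same (dot x′ y) ⟩
    false                 ∎

lincomb-false∷ : (c : BVec m) (b : BVec n) (bs : Vec (BVec n) m) →
                 lincomb (false ∷ c) (b ∷ bs) ≡ lincomb c bs
lincomb-false∷ c b bs = zipWith-second b (lincomb c bs)
  where
  zipWith-second : (u w : BVec n) → zipWith (λ _ r → r) u w ≡ w
  zipWith-second []      []      = refl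
  zipWith-second (_ ∷ u) (r ∷ w) = cong (r ∷_) (zipWith-second u w)

dots : Vec (BVec n) m → BVec n → BVec m
dots bs y = Vec.map (λ b → dot b y) bs

dots-additive : (bs : Vec (BVec n) m) → Additive (dots bs)
dots-additive []       y y′ = refl
dots-additive (b ∷ bs) y y′ = cong₂ _∷_ (dot-⊕ʳ y y′ b) (dots-additive bs y y′)

dot-lincomb : (c : BVec m) (bs : Vec (BVec n) m) (y : BVec n) →
              dot (lincomb c bs) y ≡ dot c (dots bs y)
dot-lincomb []          []       y = dot-zeroˡ y
dot-lincomb (true ∷ c)  (b ∷ bs) y =
  trans (dot-⊕ˡ b (lincomb c bs) y) (cong (dot b y xor_) (dot-lincomb c bs y))
dot-lincomb (false ∷ c) (b ∷ bs) y =
  trans (cong (λ v → dot v y) (lincomb-false∷ c b bs)) (dot-lincomb c bs y)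

lincomb-additive : (bs : Vec (BVec n) m) → Additive (λ c → lincomb c bs)
lincomb-additive bs c c′ = dot-injectiveˡ _ _ λ y → begin
  dot (lincomb (c ⊕ c′) bs) y
    ≡⟨ dot-lincomb (c ⊕ c′) bs y ⟩
  dot (c ⊕ c′) (dots bs y)
    ≡⟨ dot-⊕ˡ c c′ (dots bs y) ⟩
  dot c (dots bs y) xor dot c′ (dots bs y)
    ≡⟨ cong₂ _xor_ (dot-lincomb c bs y) (dot-lincomb c′ bs y) ⟨
  dot (lincomb c bs) y xor dot (lincomb c′ bs) y
    ≡⟨ dot-⊕ˡ (lincomb c bs) (lincomb c′ bs) y ⟨
  dot (lincomb c bs ⊕ lincomb c′ bs) y ∎
  where open ≡-Reasoning

additive-lincomb : {P : BVec n → BVec m} → Additive P →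
                   ∀ {k} (c : BVec k) vs → P (lincomb c vs) ≡ lincomb c (Vec.map P vs)
additive-lincomb add []          []       = additive-zero add
additive-lincomb add (true ∷ c)  (v ∷ vs) =
  trans (add v (lincomb c vs)) (cong (_ ⊕_) (additive-lincomb add c vs))
additive-lincomb {P = P} add (false ∷ c) (v ∷ vs) = begin
  P (lincomb (false ∷ c) (v ∷ vs))  ≡⟨ cong P (lincomb-false∷ c v vs) ⟩
  P (lincomb c vs)                  ≡⟨ additive-lincomb add c vs ⟩
  lincomb c (Vec.map P vs)          ≡⟨ lincomb-false∷ c (P v) (Vec.map P vs) ⟨
  lincomb (false ∷ c) (P v ∷ Vec.map P vs) ∎
  where open ≡-Reasoning

standardBasis : (m : ℕ) → Vec (BVec m) m
standardBasis zero    = []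
standardBasis (suc m) = (true ∷ zeroV) ∷ Vec.map (false ∷_) (standardBasis m)

lincomb-map-false∷ : (c : BVec m) (bs : Vec (BVec n) m) →
                     lincomb c (Vec.map (false ∷_) bs) ≡ false ∷ lincomb c bs
lincomb-map-false∷ c bs = sym (additive-lincomb (λ _ _ → refl) c bs)

lincomb-standardBasis : (c : BVec m) → lincomb c (standardBasis m) ≡ c
lincomb-standardBasis []          = refl
lincomb-standardBasis (true ∷ c)  = begin
  (true ∷ zeroV) ⊕ lincomb c (Vec.map (false ∷_) (standardBasis _))
    ≡⟨ cong ((true ∷ zeroV) ⊕_) (lincomb-map-false∷ c (standardBasis _)) ⟩
  true ∷ (zeroV ⊕ lincomb c (standardBasis _))
    ≡⟨ cong (true ∷_) (trans (⊕-identityˡ _) (lincomb-standardBasis c)) ⟩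
  true ∷ c ∎
  where open ≡-Reasoning
lincomb-standardBasis (false ∷ c) = begin
  lincomb (false ∷ c) (standardBasis (suc _))
    ≡⟨ lincomb-false∷ c (true ∷ zeroV) _ ⟩
  lincomb c (Vec.map (false ∷_) (standardBasis _))
    ≡⟨ lincomb-map-false∷ c (standardBasis _) ⟩
  false ∷ lincomb c (standardBasis _)
    ≡⟨ cong (false ∷_) (lincomb-standardBasis c) ⟩
  false ∷ c ∎
  where open ≡-Reasoning

lincomb-∈ : {W : VSet n} → IsSubspace W → {vs : Vec (BVec n) m} →
            All (λ v → W v ≡ true) vs → ∀ c → W (lincomb c vs) ≡ true
lincomb-∈ (0∈W , _)       []           []          = 0∈W
lincomb-∈ W-sub@(_ , ⊕∈W) (v∈W ∷ vs∈W) (true ∷ c)  = ⊕∈W _ _ v∈W (lincomb-∈ W-sub vs∈W c)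
lincomb-∈ {W = W} W-sub   (_ ∷ vs∈W)   (false ∷ c) =
  subst (λ v → W v ≡ true) (sym (lincomb-false∷ c _ _)) (lincomb-∈ W-sub vs∈W c)

-- Coordinate projections

proj : (J : Subset n) → BVec n → BVec ∣ J ∣
proj []          []      = []
proj (true ∷ J)  (a ∷ x) = a ∷ proj J x
proj (false ∷ J) (_ ∷ x) = proj J x

emb : (J : Subset n) → BVec ∣ J ∣ → BVec n
emb []          []      = []
emb (true ∷ J)  (a ∷ d) = a ∷ emb J d
emb (false ∷ J) d       = false ∷ emb J d

ones : BVec m
ones = replicate _ true

proj-additive : (J : Subset n) → Additive (proj J)
proj-additive []          []      []      = refl
proj-additive (true ∷ J)  (_ ∷ x) (_ ∷ y) = cong (_ ∷_) (proj-additive J x y)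
proj-additive (false ∷ J) (_ ∷ x) (_ ∷ y) = proj-additive J x y

emb-additive : (J : Subset n) → Additive (emb J)
emb-additive []          []      []      = refl
emb-additive (true ∷ J)  (_ ∷ d) (_ ∷ e) = cong (_ ∷_) (emb-additive J d e)
emb-additive (false ∷ J) d       e       = cong (false ∷_) (emb-additive J d e)

proj-emb : (J : Subset n) (d : BVec ∣ J ∣) → proj J (emb J d) ≡ d
proj-emb []          []      = refl
proj-emb (true ∷ J)  (a ∷ d) = cong (a ∷_) (proj-emb J d)
proj-emb (false ∷ J) d       = proj-emb J d

proj-∁-emb : (J : Subset n) (d : BVec ∣ J ∣) → proj (∁ J) (emb J d) ≡ zeroV
proj-∁-emb []          []      = refl
proj-∁-emb (true ∷ J)  (_ ∷ d) = proj-∁-emb J d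
proj-∁-emb (false ∷ J) d       = cong (false ∷_) (proj-∁-emb J d)

emb-proj : (J : Subset n) (z : BVec n) → proj (∁ J) z ≡ zeroV → emb J (proj J z) ≡ z
emb-proj []          []      _ = refl
emb-proj (true ∷ J)  (a ∷ z) e = cong (a ∷_) (emb-proj J z e)
emb-proj (false ∷ J) (a ∷ z) e =
  cong₂ _∷_ (sym (cong Vec.head e)) (emb-proj J z (cong Vec.tail e))

dot-emb : (J : Subset n) (x : BVec n) (d : BVec ∣ J ∣) → dot x (emb J d) ≡ dot (proj J x) d
dot-emb []          []      []      = refl
dot-emb (true ∷ J)  (a ∷ x) (b ∷ d) = cong ((a ∧ b) xor_) (dot-emb J x d)
dot-emb (false ∷ J) (a ∷ x) d       = trans (cong (_xor _) (∧-zeroʳ a)) (dot-emb J x d)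

monomial≡true⇒ : (J : Subset n) (x : BVec n) → monomial J x ≡ true → proj J x ≡ ones
monomial≡true⇒ []          []      _ = refl
monomial≡true⇒ (true ∷ J)  (a ∷ x) e with ∧≡true⁻ {a} e
... | refl , e′ = cong (true ∷_) (monomial≡true⇒ J x e′)
monomial≡true⇒ (false ∷ J) (_ ∷ x) e = monomial≡true⇒ J x e

monomial-at-ones : (J : Subset n) (x : BVec n) → proj J x ≡ ones → monomial J x ≡ true
monomial-at-ones []          []         _ = refl
monomial-at-ones (true ∷ J)  (true ∷ x) e = monomial-at-ones J x (cong Vec.tail e)
monomial-at-ones (false ∷ J) (_ ∷ x)    e = monomial-at-ones J x e

monomial-⊕-invariant : (J : Subset n) (x w : BVec n) → proj J w ≡ zeroV →
                       monomial J (x ⊕ w) ≡ monomial J x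
monomial-⊕-invariant []          []      []          _ = refl
monomial-⊕-invariant (true ∷ J)  (a ∷ x) (false ∷ w) e =
  cong₂ _∧_ (xor-identityʳ a) (monomial-⊕-invariant J x w (cong Vec.tail e))
monomial-⊕-invariant (false ∷ J) (_ ∷ x) (_ ∷ w)     e = monomial-⊕-invariant J x w e

-- Sums over F₂ⁿ

Sum : (BVec n → Bool) → Bool
Sum {zero}  h = h []
Sum {suc n} h = Sum (h ∘ (false ∷_)) xor Sum (h ∘ (true ∷_))

xorSum-++ : (xs ys : List Bool) → xorSum (xs L.++ ys) ≡ xorSum xs xor xorSum ys
xorSum-++ []       ys = refl
xorSum-++ (x ∷ xs) ys = trans (cong (x xor_) (xorSum-++ xs ys)) (sym (xor-assoc x _ _))

xorSum-allVecs : (h : BVec n → Bool) → xorSum (L.map h (allVecs n)) ≡ Sum h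
xorSum-allVecs {zero}  h = xor-identityʳ (h [])
xorSum-allVecs {suc n} h = begin
  xorSum (L.map h (L.map (false ∷_) vs L.++ L.map (true ∷_) vs))
    ≡⟨ cong xorSum (LP.map-++ h (L.map (false ∷_) vs) _) ⟩
  xorSum (L.map h (L.map (false ∷_) vs) L.++ L.map h (L.map (true ∷_) vs))
    ≡⟨ xorSum-++ (L.map h (L.map (false ∷_) vs)) _ ⟩
  xorSum (L.map h (L.map (false ∷_) vs)) xor xorSum (L.map h (L.map (true ∷_) vs))
    ≡⟨ cong₂ (λ xs ys → xorSum xs xor xorSum ys) (LP.map-∘ vs) (LP.map-∘ vs) ⟨
  xorSum (L.map (h ∘ (false ∷_)) vs) xor xorSum (L.map (h ∘ (true ∷_)) vs)
    ≡⟨ cong₂ _xor_ (xorSum-allVecs (h ∘ (false ∷_))) (xorSum-allVecs (h ∘ (true ∷_))) ⟩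
  Sum h ∎
  where
  open ≡-Reasoning
  vs = allVecs n

Sum-cong : {h g : BVec n → Bool} → (∀ x → h x ≡ g x) → Sum h ≡ Sum g
Sum-cong {zero}  h≗g = h≗g []
Sum-cong {suc n} h≗g = cong₂ _xor_ (Sum-cong (h≗g ∘ (false ∷_))) (Sum-cong (h≗g ∘ (true ∷_)))

Sum-false : {h : BVec n → Bool} → (∀ x → h x ≡ false) → Sum h ≡ false
Sum-false {zero}  h≗0 = h≗0 []
Sum-false {suc n} h≗0 = cong₂ _xor_ (Sum-false (h≗0 ∘ (false ∷_))) (Sum-false (h≗0 ∘ (true ∷_)))

Sum-xor : (h g : BVec n → Bool) → Sum (λ x → h x xor g x) ≡ Sum h xor Sum g
Sum-xor {zero}  h g = refl
Sum-xor {suc n} h g = trans (cong₂ _xor_ (Sum-xor h₀ g₀) (Sum-xor h₁ g₁))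
                            (xor-interchange (Sum h₀) (Sum g₀) (Sum h₁) (Sum g₁))
  where
  h₀ = h ∘ (false ∷_); h₁ = h ∘ (true ∷_); g₀ = g ∘ (false ∷_); g₁ = g ∘ (true ∷_)

∧-Sum : (a : Bool) (h : BVec n → Bool) → a ∧ Sum h ≡ Sum (λ x → a ∧ h x)
∧-Sum     true  h = refl
∧-Sum {n} false h = sym (Sum-false {n} {λ _ → false} λ _ → refl)

Sum-comm : (H : BVec m → BVec n → Bool) →
           Sum (λ x → Sum (λ y → H x y)) ≡ Sum (λ y → Sum (λ x → H x y))
Sum-comm {zero}  H = refl
Sum-comm {suc m} H = trans (cong₂ _xor_ (Sum-comm H₀) (Sum-comm H₁))
                           (sym (Sum-xor (λ y → Sum (λ x → H₀ x y)) (λ y → Sum (λ x → H₁ x y))))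
  where
  H₀ = H ∘ (false ∷_); H₁ = H ∘ (true ∷_)

Sum-∁ : (h : Subset n → Bool) → Sum (λ I → h (∁ I)) ≡ Sum h
Sum-∁ {zero}  h = refl
Sum-∁ {suc n} h = trans (cong₂ _xor_ (Sum-∁ (h ∘ (true ∷_))) (Sum-∁ (h ∘ (false ∷_))))
                        (xor-comm (Sum (h ∘ (true ∷_))) (Sum (h ∘ (false ∷_))))

Sum-shift : (h : BVec n → Bool) (v : BVec n) → Sum (λ x → h (x ⊕ v)) ≡ Sum h
Sum-shift {zero}  h []          = refl
Sum-shift {suc n} h (false ∷ v) = cong₂ _xor_ (Sum-shift _ v) (Sum-shift _ v)
Sum-shift {suc n} h (true ∷ v)  = trans (cong₂ _xor_ (Sum-shift _ v) (Sum-shift _ v))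
                                        (xor-comm (Sum (h ∘ (true ∷_))) (Sum (h ∘ (false ∷_))))

-- x ↦ x ⊕ v is a fixed-point-free involution, so the terms of the sum cancel in pairs.
Sum-shift-invariant : (h : BVec n → Bool) (v : BVec n) → v ≢ zeroV →
                      (∀ x → h (x ⊕ v) ≡ h x) → Sum h ≡ false
Sum-shift-invariant {zero}  h []          v≢0 _   = ⊥-elim (v≢0 refl)
Sum-shift-invariant {suc n} h (false ∷ v) v≢0 inv =
  cong₂ _xor_ (Sum-shift-invariant _ v (v≢0 ∘ cong (false ∷_)) (inv ∘ (false ∷_)))
              (Sum-shift-invariant _ v (v≢0 ∘ cong (false ∷_)) (inv ∘ (true ∷_)))
Sum-shift-invariant {suc n} h (true ∷ v)  _   inv = begin
  Sum (h ∘ (false ∷_)) xor Sum h₁   ≡⟨ cong (_xor Sum h₁) (Sum-cong λ x → sym (inv (false ∷ x))) ⟩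
  Sum (λ x → h₁ (x ⊕ v)) xor Sum h₁ ≡⟨ cong (_xor Sum h₁) (Sum-shift h₁ v) ⟩
  Sum h₁ xor Sum h₁                 ≡⟨ xor-same (Sum h₁) ⟩
  false                             ∎
  where
  open ≡-Reasoning
  h₁ = h ∘ (true ∷_)

Sum-unique : (h : BVec n → Bool) (x₀ : BVec n) → h x₀ ≡ true →
             (∀ x → h x ≡ true → x ≡ x₀) → Sum h ≡ true
Sum-unique {zero}  h []           hx₀ _    = hx₀
Sum-unique {suc n} h (false ∷ x₀) hx₀ uniq = cong₂ _xor_
  (Sum-unique _ x₀ hx₀ λ x hx → cong Vec.tail (uniq (false ∷ x) hx))
  (Sum-false λ x → ¬-not λ hx → case uniq (true ∷ x) hx of λ ())
Sum-unique {suc n} h (true ∷ x₀)  hx₀ uniq = cong₂ _xor_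
  (Sum-false λ x → ¬-not λ hx → case uniq (false ∷ x) hx of λ ())
  (Sum-unique _ x₀ hx₀ λ x hx → cong Vec.tail (uniq (true ∷ x) hx))

Sum≡true⇒∃ : (h : BVec n → Bool) → Sum h ≡ true → ∃ λ x → h x ≡ true
Sum≡true⇒∃ {zero}  h e = [] , e
Sum≡true⇒∃ {suc n} h e with Sum (h ∘ (false ∷_)) in e₀
... | true  = let x , hx = Sum≡true⇒∃ _ e₀ in false ∷ x , hx
... | false = let x , hx = Sum≡true⇒∃ _ e  in true ∷ x , hx

sumOver≡Sum : (W : VSet n) (g : BoolFun n) → sumOver W g ≡ Sum (λ x → W x ∧ g x)
sumOver≡Sum W g = xorSum-allVecs (λ x → W x ∧ g x)

-- Orthogonal complements

Orthogonal : VSet n → BVec n → Set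
Orthogonal U y = ∀ u → U u ≡ true → dot u y ≡ false

allVecs-complete : (x : BVec n) → x ∈ allVecs n
allVecs-complete []          = here refl
allVecs-complete (false ∷ x) = ∈-++⁺ˡ (∈-map⁺ (false ∷_) (allVecs-complete x))
allVecs-complete (true ∷ x)  = ∈-++⁺ʳ _ (∈-map⁺ (true ∷_) (allVecs-complete x))

perp⇒orthogonal : (U : VSet n) (y : BVec n) → perp U y ≡ true → Orthogonal U y
perp⇒orthogonal U y y∈U⊥ u u∈U =
  not-injective (foldr-∧⁻ (allVecs _) y∈U⊥ (allVecs-complete u))
  where
  foldr-∧⁻ : ∀ xs → L.foldr (λ u r → (not (U u) ∨ not (dot u y)) ∧ r) true xs ≡ true →
             u ∈ xs → not (dot u y) ≡ true
  foldr-∧⁻ (x ∷ xs) e (here refl) with ∧≡true⁻ {not (U u) ∨ _} e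
  ... | e₁ , _ rewrite u∈U = e₁
  foldr-∧⁻ (x ∷ xs) e (there u∈xs) =
    foldr-∧⁻ xs (proj₂ (∧≡true⁻ {not (U x) ∨ _} e)) u∈xs

orthogonal⇒perp : (U : VSet n) (y : BVec n) → Orthogonal U y → perp U y ≡ true
orthogonal⇒perp U y y⊥U = foldr-∧⁺ (allVecs _)
  where
  orthogonal-at : ∀ u → not (U u) ∨ not (dot u y) ≡ true
  orthogonal-at u with U u in u∈U
  ... | false = refl
  ... | true  = cong not (y⊥U u u∈U)
  foldr-∧⁺ : ∀ xs → L.foldr (λ u r → (not (U u) ∨ not (dot u y)) ∧ r) true xs ≡ true
  foldr-∧⁺ []       = refl
  foldr-∧⁺ (x ∷ xs) = cong₂ _∧_ (orthogonal-at x) (foldr-∧⁺ xs)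

perp-isSubspace : (U : VSet n) → IsSubspace (perp U)
perp-isSubspace U =
  orthogonal⇒perp U zeroV (λ u _ → dot-zeroʳ u) ,
  λ x y x∈U⊥ y∈U⊥ → orthogonal⇒perp U (x ⊕ y) λ u u∈U → begin
    dot u (x ⊕ y)
      ≡⟨ dot-⊕ʳ x y u ⟩
    dot u x xor dot u y
      ≡⟨ cong₂ _xor_ (perp⇒orthogonal U x x∈U⊥ u u∈U) (perp⇒orthogonal U y y∈U⊥ u u∈U) ⟩
    false ∎
  where open ≡-Reasoning

module _ {U : VSet n} {b : Vec (BVec n) m} (b-basis : IsBasis U b) where

  private
    lincomb-∈U : ∀ c → U (lincomb c b) ≡ true
    lincomb-∈U = proj₁ (proj₂ b-basis)
    span : ∀ x → U x ≡ true → ∃ λ c → lincomb c b ≡ x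
    span = proj₂ (proj₂ b-basis)

  orthogonal⇒dots≡zero : ∀ y → Orthogonal U y → dots b y ≡ zeroV
  orthogonal⇒dots≡zero y y⊥U = orthogonal-to-all⇒zero (dots b y) λ c →
    trans (sym (dot-lincomb c b y)) (y⊥U (lincomb c b) (lincomb-∈U c))

  dots≡zero⇒orthogonal : ∀ y → dots b y ≡ zeroV → Orthogonal U y
  dots≡zero⇒orthogonal y by≡0 u u∈U with span u u∈U
  ... | c , refl = trans (dot-lincomb c b y) (trans (cong (dot c) by≡0) (dot-zeroʳ c))

-- Square matrices over F₂

BVec↔Fin : (m : ℕ) → BVec m ↔ Fin (2 ^ m)
BVec↔Fin m =
  ↔-trans (mk↔ₛ′ Vecʳ.fromVec (Vecʳ.toVec m) (Vecʳ.fromVec∘toVec m) Vecʳ.toVec∘fromVec)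
  (↔-trans (Vecʳ.lift↔ m (↔-sym 2↔Bool)) (↔-sym (Vecʳ.Fin[m^n]↔Fin[m]^n 2 m)))

-- If y were missed, punching it out would inject Fin (suc N) into Fin N.
Fin-injective⇒surjective : ∀ {N} (g : Fin N → Fin N) →
                           Injective _≡_ _≡_ g → StrictlySurjective _≡_ g
Fin-injective⇒surjective {suc N} g g-inj y with any? (λ x → g x Fin.≟ y)
... | yes found  = found
... | no  missed = contradiction (injective⇒≤ h-inj) 1+n≰n
  where
  y≢g : ∀ x → y ≢ g x
  y≢g x y≡gx = missed (x , sym y≡gx)
  h : Fin (suc N) → Fin N
  h x = Fin.punchOut (y≢g x)
  h-inj : Injective _≡_ _≡_ h
  h-inj {x} {x′} = g-inj ∘ punchOut-injective (y≢g x) (y≢g x′)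

finite-injective⇒surjective : ∀ {N} {A : Set} → A ↔ Fin N →
                              (g : A → A) → Injective _≡_ _≡_ g → StrictlySurjective _≡_ g
finite-injective⇒surjective A↔Fin g g-inj y =
  let i , gᶠi≡toy = Fin-injective⇒surjective (to ∘ g ∘ from) gᶠ-inj (to y)
  in  from i , to-injective gᶠi≡toy
  where
  open Inverse A↔Fin using (to; from)
  to-injective : Injective _≡_ _≡_ to
  to-injective = Injection.injective (↔⇒↣ A↔Fin)
  gᶠ-inj : Injective _≡_ _≡_ (to ∘ g ∘ from)
  gᶠ-inj = Injection.injective (↔⇒↣ (↔-sym A↔Fin)) ∘ g-inj ∘ to-injective

trivialKernel⇒injective : {A : BVec n → BVec m} → Additive A → TrivialKernel A →
                          Injective _≡_ _≡_ A
trivialKernel⇒injective add ker =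
  trivialKernelOn⇒injectiveOn (refl , λ _ _ _ _ → refl) add (λ x _ → ker x) refl refl

adjoint-trivialKernel : {A B : BVec m → BVec m} → Additive A →
                        (∀ c d → dot (A c) d ≡ dot c (B d)) →
                        TrivialKernel A → TrivialKernel B
adjoint-trivialKernel {m} {A} {B} add adj ker d Bd≡0 = orthogonal-to-all⇒zero d λ r →
  let c , Ac≡r = finite-injective⇒surjective (BVec↔Fin m) A (trivialKernel⇒injective add ker) r in
  begin
    dot r d       ≡⟨ cong (λ v → dot v d) Ac≡r ⟨
    dot (A c) d   ≡⟨ adj c d ⟩
    dot c (B d)   ≡⟨ cong (dot c) Bd≡0 ⟩
    dot c zeroV   ≡⟨ dot-zeroʳ c ⟩
    false         ∎
  where open ≡-Reasoning

-- Subspaces projecting isomorphically onto a set of coordinates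

subspace-⊕-invariant : {W : VSet n} → IsSubspace W →
                       ∀ {w} → W w ≡ true → ∀ x → W (x ⊕ w) ≡ W x
subspace-⊕-invariant {W = W} (_ , ⊕∈W) {w} w∈W x = ≡true⇔⇒≡
  (λ x⊕w∈W → subst (λ v → W v ≡ true) (⊕-cancelʳ x w) (⊕∈W _ _ x⊕w∈W w∈W))
  (λ x∈W → ⊕∈W _ _ x∈W w∈W)

sumOver-monomial≡true⇒trivialKernel : {W : VSet n} → IsSubspace W → (J : Subset n) →
  sumOver W (monomial J) ≡ true → TrivialKernelOn W (proj J)
sumOver-monomial≡true⇒trivialKernel {W = W} W-sub J sum≡true w w∈W Jw≡0
  with ≡-dec Bool._≟_ w zeroV
... | yes w≡0 = w≡0
... | no  w≢0 = contradiction (trans (sym sum≡true) sum≡false) λ ()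
  where
  sum≡false : sumOver W (monomial J) ≡ false
  sum≡false = trans (sumOver≡Sum W (monomial J))
    (Sum-shift-invariant _ w w≢0 λ x →
      cong₂ _∧_ (subspace-⊕-invariant W-sub w∈W x) (monomial-⊕-invariant J x w Jw≡0))

record ProjectsIsomorphically (W : VSet n) (J : Subset n) : Set where
  field
    proj-trivialKernel : TrivialKernelOn W (proj J)
    lift      : BVec ∣ J ∣ → BVec n
    lift-∈    : ∀ p → W (lift p) ≡ true
    proj-lift : ∀ p → proj J (lift p) ≡ p

module _ {W : VSet n} (W-sub : IsSubspace W) {J : Subset n} (W≅J : ProjectsIsomorphically W J) where

  open ProjectsIsomorphically W≅J

  proj-injectiveOn : ∀ {x y} → W x ≡ true → W y ≡ true → proj J x ≡ proj J y → x ≡ y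
  proj-injectiveOn = trivialKernelOn⇒injectiveOn W-sub (proj-additive J) proj-trivialKernel

  projectsIsomorphically⇒sumOver-monomial≡true : sumOver W (monomial J) ≡ true
  projectsIsomorphically⇒sumOver-monomial≡true =
    trans (sumOver≡Sum W (monomial J)) (Sum-unique _ (lift ones) lift-ones∈ unique)
    where
    lift-ones∈ : W (lift ones) ∧ monomial J (lift ones) ≡ true
    lift-ones∈ = cong₂ _∧_ (lift-∈ ones) (monomial-at-ones J (lift ones) (proj-lift ones))
    unique : ∀ x → W x ∧ monomial J x ≡ true → x ≡ lift ones
    unique x x∈ with ∧≡true⁻ {W x} x∈
    ... | x∈W , Jx = proj-injectiveOn x∈W (lift-∈ ones)
                      (trans (monomial≡true⇒ J x Jx) (sym (proj-lift ones)))

  projectsIsomorphically⇒hasDim : HasDim W ∣ J ∣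
  projectsIsomorphically⇒hasDim = basis , independent , lincomb-∈ W-sub basis-∈ , spans
    where
    basis : Vec (BVec n) ∣ J ∣
    basis = Vec.map lift (standardBasis ∣ J ∣)
    basis-∈ : All (λ v → W v ≡ true) basis
    basis-∈ = All.map⁺ (All.universal lift-∈ (standardBasis ∣ J ∣))
    proj-lincomb : ∀ c → proj J (lincomb c basis) ≡ c
    proj-lincomb c = begin
      proj J (lincomb c basis)
        ≡⟨ additive-lincomb (proj-additive J) c basis ⟩
      lincomb c (Vec.map (proj J) basis)
        ≡⟨ cong (lincomb c) (VP.map-∘ (proj J) lift _) ⟨
      lincomb c (Vec.map (proj J ∘ lift) (standardBasis ∣ J ∣))
        ≡⟨ cong (lincomb c) (trans (VP.map-cong proj-lift _) (VP.map-id _)) ⟩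
      lincomb c (standardBasis ∣ J ∣)
        ≡⟨ lincomb-standardBasis c ⟩
      c ∎
      where open ≡-Reasoning
    independent : LinIndep basis
    independent c e = begin
      c                        ≡⟨ proj-lincomb c ⟨
      proj J (lincomb c basis) ≡⟨ cong (proj J) e ⟩
      proj J zeroV             ≡⟨ additive-zero (proj-additive J) ⟩
      zeroV                    ∎
      where open ≡-Reasoning
    spans : ∀ x → W x ≡ true → ∃ λ c → lincomb c basis ≡ x
    spans x x∈W = proj J x ,
      proj-injectiveOn (lincomb-∈ W-sub basis-∈ (proj J x)) x∈W (proj-lincomb (proj J x))

-- M is the square submatrix of the basis matrix of U on the columns I, and Mᵀ its transpose.
module SquareMinor {U : VSet n} (U-sub : IsSubspace U) (I : Subset n) (U-dim : HasDim U ∣ I ∣) where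

  private
    b : Vec (BVec n) ∣ I ∣
    b = proj₁ U-dim
    b-basis : IsBasis U b
    b-basis = proj₂ U-dim
    b-independent : LinIndep b
    b-independent = proj₁ b-basis
    lincomb-∈U : ∀ c → U (lincomb c b) ≡ true
    lincomb-∈U = proj₁ (proj₂ b-basis)
    span : ∀ x → U x ≡ true → ∃ λ c → lincomb c b ≡ x
    span = proj₂ (proj₂ b-basis)

  M : BVec ∣ I ∣ → BVec ∣ I ∣
  M c = proj I (lincomb c b)

  Mᵀ : BVec ∣ I ∣ → BVec ∣ I ∣
  Mᵀ d = dots b (emb I d)

  M-additive : Additive M
  M-additive c c′ = trans (cong (proj I) (lincomb-additive b c c′)) (proj-additive I _ _)

  Mᵀ-additive : Additive Mᵀ
  Mᵀ-additive d d′ = trans (cong (dots b) (emb-additive I d d′)) (dots-additive b _ _)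

  M-adjoint : ∀ c d → dot (M c) d ≡ dot c (Mᵀ d)
  M-adjoint c d = trans (sym (dot-emb I (lincomb c b) d)) (dot-lincomb c b (emb I d))

  Mᵀ-adjoint : ∀ d c → dot (Mᵀ d) c ≡ dot d (M c)
  Mᵀ-adjoint d c = begin
    dot (Mᵀ d) c   ≡⟨ dot-comm (Mᵀ d) c ⟩
    dot c (Mᵀ d)   ≡⟨ M-adjoint c d ⟨
    dot (M c) d    ≡⟨ dot-comm (M c) d ⟩
    dot d (M c)    ∎
    where open ≡-Reasoning

  proj-trivialKernel⇒M-trivialKernel : TrivialKernelOn U (proj I) → TrivialKernel M
  proj-trivialKernel⇒M-trivialKernel ker c Mc≡0 =
    b-independent c (ker (lincomb c b) (lincomb-∈U c) Mc≡0)

  U≅I : TrivialKernel M → ProjectsIsomorphically U I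
  U≅I ker = record
    { proj-trivialKernel = I-trivialKernel
    ; lift               = λ p → lincomb (M⁻¹ p) b
    ; lift-∈             = λ p → lincomb-∈U (M⁻¹ p)
    ; proj-lift          = λ p → proj₂ (M-onto p)
    }
    where
    I-trivialKernel : TrivialKernelOn U (proj I)
    I-trivialKernel x x∈U Ix≡0 with span x x∈U
    ... | c , refl = trans (cong (λ c → lincomb c b) (ker c Ix≡0)) (additive-zero (lincomb-additive b))
    M-onto : StrictlySurjective _≡_ M
    M-onto = finite-injective⇒surjective (BVec↔Fin _) M
               (trivialKernel⇒injective M-additive ker)
    M⁻¹ : BVec ∣ I ∣ → BVec ∣ I ∣
    M⁻¹ p = proj₁ (M-onto p)

  private
    perp⇒dots≡zero : ∀ y → perp U y ≡ true → dots b y ≡ zeroV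
    perp⇒dots≡zero y y∈U⊥ = orthogonal⇒dots≡zero b-basis y (perp⇒orthogonal U y y∈U⊥)
    dots≡zero⇒perp : ∀ y → dots b y ≡ zeroV → perp U y ≡ true
    dots≡zero⇒perp y by≡0 = orthogonal⇒perp U y (dots≡zero⇒orthogonal b-basis y by≡0)

  proj-trivialKernel⇒Mᵀ-trivialKernel : TrivialKernelOn (perp U) (proj (∁ I)) → TrivialKernel Mᵀ
  proj-trivialKernel⇒Mᵀ-trivialKernel ker d Mᵀd≡0 = begin
    d                ≡⟨ proj-emb I d ⟨
    proj I (emb I d) ≡⟨ cong (proj I) (ker (emb I d) emb-d∈U⊥ (proj-∁-emb I d)) ⟩
    proj I zeroV     ≡⟨ additive-zero (proj-additive I) ⟩
    zeroV            ∎
    where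
    open ≡-Reasoning
    emb-d∈U⊥ : perp U (emb I d) ≡ true
    emb-d∈U⊥ = dots≡zero⇒perp (emb I d) Mᵀd≡0

  U⊥≅∁I : TrivialKernel Mᵀ → ProjectsIsomorphically (perp U) (∁ I)
  U⊥≅∁I ker = record
    { proj-trivialKernel = ∁I-trivialKernel
    ; lift               = lift
    ; lift-∈             = lift-∈
    ; proj-lift          = proj-lift
    }
    where
    open ≡-Reasoning
    Mᵀ-onto : StrictlySurjective _≡_ Mᵀ
    Mᵀ-onto = finite-injective⇒surjective (BVec↔Fin _) Mᵀ
                (trivialKernel⇒injective Mᵀ-additive ker)
    Mᵀ⁻¹ : BVec ∣ I ∣ → BVec ∣ I ∣
    Mᵀ⁻¹ r = proj₁ (Mᵀ-onto r)

    ∁I-trivialKernel : TrivialKernelOn (perp U) (proj (∁ I))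
    ∁I-trivialKernel y y∈U⊥ ∁Iy≡0 = begin
      y                ≡⟨ emb-proj I y ∁Iy≡0 ⟨
      emb I (proj I y) ≡⟨ cong (emb I) (ker (proj I y) Mᵀ-Iy≡0) ⟩
      emb I zeroV      ≡⟨ additive-zero (emb-additive I) ⟩
      zeroV            ∎
      where
      Mᵀ-Iy≡0 : Mᵀ (proj I y) ≡ zeroV
      Mᵀ-Iy≡0 = trans (cong (dots b) (emb-proj I y ∁Iy≡0)) (perp⇒dots≡zero y y∈U⊥)

    -- The I-coordinates are chosen to make lift p orthogonal to every basis vector of U.
    lift : BVec ∣ ∁ I ∣ → BVec n
    lift p = emb (∁ I) p ⊕ emb I (Mᵀ⁻¹ (dots b (emb (∁ I) p)))

    lift-∈ : ∀ p → perp U (lift p) ≡ true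
    lift-∈ p = dots≡zero⇒perp (lift p) (begin
      dots b (lift p)
        ≡⟨ dots-additive b (emb (∁ I) p) _ ⟩
      dots b (emb (∁ I) p) ⊕ Mᵀ (Mᵀ⁻¹ (dots b (emb (∁ I) p)))
        ≡⟨ cong (_ ⊕_) (proj₂ (Mᵀ-onto _)) ⟩
      dots b (emb (∁ I) p) ⊕ dots b (emb (∁ I) p)
        ≡⟨ ⊕-self _ ⟩
      zeroV ∎)

    proj-lift : ∀ p → proj (∁ I) (lift p) ≡ p
    proj-lift p = begin
      proj (∁ I) (lift p)
        ≡⟨ proj-additive (∁ I) (emb (∁ I) p) _ ⟩
      proj (∁ I) (emb (∁ I) p) ⊕ proj (∁ I) (emb I _)
        ≡⟨ cong₂ _⊕_ (proj-emb (∁ I) p) (proj-∁-emb I _) ⟩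
      p ⊕ zeroV
        ≡⟨ ⊕-identityʳ p ⟩
      p ∎

  sumOver-monomial≡true⇒Mᵀ-trivialKernel : sumOver U (monomial I) ≡ true → TrivialKernel Mᵀ
  sumOver-monomial≡true⇒Mᵀ-trivialKernel sum≡true = adjoint-trivialKernel M-additive M-adjoint
    (proj-trivialKernel⇒M-trivialKernel (sumOver-monomial≡true⇒trivialKernel U-sub I sum≡true))

  sumOver-perp-monomial≡true⇒M-trivialKernel :
    sumOver (perp U) (monomial (∁ I)) ≡ true → TrivialKernel M
  sumOver-perp-monomial≡true⇒M-trivialKernel sum≡true = adjoint-trivialKernel Mᵀ-additive Mᵀ-adjoint
    (proj-trivialKernel⇒Mᵀ-trivialKernel (sumOver-monomial≡true⇒trivialKernel (perp-isSubspace U) (∁ I) sum≡true))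

  sumOver-monomial-perp : sumOver U (monomial I) ≡ sumOver (perp U) (monomial (∁ I))
  sumOver-monomial-perp = ≡true⇔⇒≡
    (λ sum≡true → projectsIsomorphically⇒sumOver-monomial≡true (perp-isSubspace U)
                    (U⊥≅∁I (sumOver-monomial≡true⇒Mᵀ-trivialKernel sum≡true)))
    (λ sum≡true → projectsIsomorphically⇒sumOver-monomial≡true U-sub
                    (U≅I (sumOver-perp-monomial≡true⇒M-trivialKernel sum≡true)))

  perp-hasDim : sumOver U (monomial I) ≡ true → HasDim (perp U) ∣ ∁ I ∣
  perp-hasDim sum≡true = projectsIsomorphically⇒hasDim (perp-isSubspace U)
    (U⊥≅∁I (sumOver-monomial≡true⇒Mᵀ-trivialKernel sum≡true))

-- Expansion into monomials

∁-involutive : (I : Subset n) → ∁ (∁ I) ≡ I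
∁-involutive I =
  trans (sym (VP.map-∘ not not I)) (trans (VP.map-cong not-involutive I) (VP.map-id I))

sumOver-eval : (W : VSet n) (f : ANF n) →
               sumOver W (eval f) ≡ Sum (λ I → f I ∧ sumOver W (monomial I))
sumOver-eval W f = begin
  sumOver W (eval f)
    ≡⟨ sumOver≡Sum W (eval f) ⟩
  Sum (λ x → W x ∧ eval f x)
    ≡⟨ Sum-cong (λ x → cong (W x ∧_) (xorSum-allVecs (λ I → f I ∧ monomial I x))) ⟩
  Sum (λ x → W x ∧ Sum (λ I → f I ∧ monomial I x))
    ≡⟨ Sum-cong (λ x → ∧-Sum (W x) (λ I → f I ∧ monomial I x)) ⟩
  Sum (λ x → Sum (λ I → W x ∧ (f I ∧ monomial I x)))
    ≡⟨ Sum-comm (λ x I → W x ∧ (f I ∧ monomial I x)) ⟩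
  Sum (λ I → Sum (λ x → W x ∧ (f I ∧ monomial I x)))
    ≡⟨ Sum-cong (λ I → Sum-cong (λ x → ∧-rearrange (W x) (f I) (monomial I x))) ⟩
  Sum (λ I → Sum (λ x → f I ∧ (W x ∧ monomial I x)))
    ≡⟨ Sum-cong (λ I → ∧-Sum (f I) (λ x → W x ∧ monomial I x)) ⟨
  Sum (λ I → f I ∧ Sum (λ x → W x ∧ monomial I x))
    ≡⟨ Sum-cong (λ I → cong (f I ∧_) (sumOver≡Sum W (monomial I))) ⟨
  Sum (λ I → f I ∧ sumOver W (monomial I)) ∎
  where open ≡-Reasoning

module _ {k} {U : VSet n} (f : ANF n) (f-hom : Homogeneous k f)
         (U-sub : IsSubspace U) (U-dim : HasDim U k) where

  private
    dim-at : ∀ I → f I ≡ true → HasDim U ∣ I ∣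
    dim-at I fI = subst (HasDim U) (sym (f-hom I fI)) U-dim

  sumOver-eval-perp : sumOver U (eval f) ≡ sumOver (perp U) (eval (complementANF f))
  sumOver-eval-perp = begin
    sumOver U (eval f)
      ≡⟨ sumOver-eval U f ⟩
    Sum (λ I → f I ∧ sumOver U (monomial I))
      ≡⟨ Sum-cong termwise ⟩
    Sum (λ I → f I ∧ S⊥ (∁ I))
      ≡⟨ Sum-∁ (λ I → f I ∧ S⊥ (∁ I)) ⟨
    Sum (λ I → f (∁ I) ∧ S⊥ (∁ (∁ I)))
      ≡⟨ Sum-cong (λ I → cong (λ J → f (∁ I) ∧ S⊥ J) (∁-involutive I)) ⟩
    Sum (λ I → complementANF f I ∧ S⊥ I)
      ≡⟨ sumOver-eval (perp U) (complementANF f) ⟨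
    sumOver (perp U) (eval (complementANF f)) ∎
    where
    open ≡-Reasoning
    S⊥ : Subset n → Bool
    S⊥ J = sumOver (perp U) (monomial J)
    termwise : ∀ I → f I ∧ sumOver U (monomial I) ≡ f I ∧ S⊥ (∁ I)
    termwise I with f I in fI
    ... | false = refl
    ... | true  = SquareMinor.sumOver-monomial-perp U-sub I (dim-at I fI)

  sumOver-eval≡true⇒perp-hasDim : sumOver U (eval f) ≡ true → HasDim (perp U) (n ∸ k)
  sumOver-eval≡true⇒perp-hasDim sum≡true =
    let I , fI∧sumI≡true = Sum≡true⇒∃ _ (trans (sym (sumOver-eval U f)) sum≡true)
        fI , sumI≡true   = ∧≡true⁻ {f I} fI∧sumI≡true
    in  subst (HasDim (perp U)) (trans (∣∁p∣≡n∸∣p∣ I) (cong (_ ∸_) (f-hom I fI)))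
              (SquareMinor.perp-hasDim U-sub I (dim-at I fI) sumI≡true)

theorem5p10 : ∀ {n k : ℕ} (f : ANF n) → Homogeneous k f →
    (U : VSet n) → IsSubspace U → HasDim U k →
    (InN k (eval f) U ⇔ InN (n ∸ k) (eval (complementANF f)) (perp U))
theorem5p10 f f-hom U U-sub U-dim = mk⇔
  (λ (_ , _ , sum≡true) → perp-isSubspace U ,
                          sumOver-eval≡true⇒perp-hasDim f f-hom U-sub U-dim sum≡true ,
                          trans (sym (sumOver-eval-perp f f-hom U-sub U-dim)) sum≡true)
  (λ (_ , _ , sum≡true) → U-sub , U-dim , trans (sumOver-eval-perp f f-hom U-sub U-dim) sum≡true)
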